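{- Let $(B,+,0)$ be a fixed-point-free K-loop and $x\in B$. Then the set $C_B(x)=\{b\in B:\delta_{x,b}=\delta_{ -x,b}=\mathrm{Id}\}$ is stable under the map $y\mapsto y\cdot n$ for every $n\in\mathbb{Z}$. Moreover, $Z(C_B(x))=\{b\in C_B(x):\delta_{b,b'}=\mathrm{Id}\text{ for all }b'\in C_B(x)\}$ is a definable subloop which is an abelian group and contains the group generated by $x$.
   Context: A K-loop is a structure $(B,+,0)$ with $0+a=a+0=a$, where for all $a,b$ the equations $x+a=b$ and $a+y=b$ have unique solutions, satisfying the Bol condition $a+(b+(a+c))=(a+(b+a))+c$ and the automorphic inverse property $-(a+b)=-a-b$. For $n\in\mathbb{N}$, $a\cdot n=a+\dots+a$ ($n$ times), extended to $n\in\mathbb{Z}$ via inverses (this is well defined in K-loops). The precession maps $\delta_{a,b}$ are the permutations of $B$ characterized by $a+(b+c)=(a+b)+\delta_{a,b}(c)$ for all $c$; $D(B)$ is the group they generate. $B$ is fixed-point-free if every nontrivial $\phi\in D(B)$ fixes no nonzero element of $B$. Definable means definable with parameters in $(B,+,0)$. -}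

module Defs where

open import Data.Nat using (ℕ; zero; suc)
open import Data.Integer using (ℤ; +_; -[1+_])
open import Data.Fin using (Fin; zero; suc)
open import Data.Product using (Σ; _×_; _,_; proj₁)
open import Data.Sum using (_⊎_)
open import Data.Empty using (⊥)
open import Relation.Nullary using (¬_)
open import Relation.Binary.PropositionalEquality using (_≡_)

record KLoop : Set₁ where
  infixl 6 _+_
  field
    B    : Set
    _+_  : B → B → B
    𝟘    : B
    identityˡ : ∀ a → 𝟘 + a ≡ a
    identityʳ : ∀ a → a + 𝟘 ≡ a
    solveˡ : ∀ a b → Σ B λ x → (x + a ≡ b) × (∀ x′ → x′ + a ≡ b → x′ ≡ x)
    solveʳ : ∀ a b → Σ B λ y → (a + y ≡ b) × (∀ y′ → a + y′ ≡ b → y′ ≡ y)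

  _\\_ : B → B → B
  a \\ b = proj₁ (solveʳ a b)

  -_ : B → B
  - a = a \\ 𝟘

  field
    bol : ∀ a b c → a + (b + (a + c)) ≡ (a + (b + a)) + c
    aip : ∀ a b → - (a + b) ≡ (- a) + (- b)

module KLoopTheory (K : KLoop) where
  open KLoop K public

  δ : B → B → B → B
  δ a b c = (a + b) \\ (a + (b + c))

  -- its inverse permutation: c with (a+b)+d = a+(b+c)
  δ⁻¹ : B → B → B → B
  δ⁻¹ a b d = b \\ (a \\ ((a + b) + d))

  -- words in the generators of D(B) and their action on B
  data DWord : Set where
    idW  : DWord
    gen  : B → B → DWord
    genᴵ : B → B → DWord
    _∘W_ : DWord → DWord → DWord

  ⟦_⟧ : DWord → B → B
  ⟦ idW ⟧ c = c
  ⟦ gen a b ⟧ c = δ a b c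
  ⟦ genᴵ a b ⟧ c = δ⁻¹ a b c
  ⟦ w ∘W v ⟧ c = ⟦ w ⟧ (⟦ v ⟧ c)

  IsId : (B → B) → Set
  IsId f = ∀ c → f c ≡ c

  FixedPointFree : Set
  FixedPointFree = ∀ w → ¬ IsId ⟦ w ⟧ → ∀ b → ⟦ w ⟧ b ≡ b → b ≡ 𝟘

  _·ℕ_ : B → ℕ → B
  a ·ℕ zero = 𝟘
  a ·ℕ suc n = a + (a ·ℕ n)

  _·_ : B → ℤ → B
  a · (+ n) = a ·ℕ n
  a · -[1+ n ] = - (a ·ℕ suc n)

  C : B → B → Set
  C x b = IsId (δ x b) × IsId (δ (- x) b)

  ZC : B → B → Set
  ZC x b = C x b × (∀ b′ → C x b′ → IsId (δ b b′))

  IsSubloop : (B → Set) → Set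
  IsSubloop S = S 𝟘
    × (∀ a b → S a → S b → S (a + b))
    × (∀ a b → S a → S b → S (proj₁ (solveˡ a b)))
    × (∀ a b → S a → S b → S (proj₁ (solveʳ a b)))

  -- the induced operation on S is an abelian group (0 is the identity
  -- and the subloop is closed under inverses, so only these remain)
  IsAbelianGroupOn : (B → Set) → Set
  IsAbelianGroupOn S = (∀ a b c → S a → S b → S c → (a + b) + c ≡ a + (b + c))
    × (∀ a b → S a → S b → a + b ≡ b + a)

  -- first-order definability with parameters in the language (+, 0)

  data Term (n : ℕ) : Set where
    var : Fin n → Term n
    par : B → Term n
    zeroT : Term n
    _⊕_ : Term n → Term n → Term n

  data Formula : ℕ → Set where
    _≐_ : ∀ {n} → Term n → Term n → Formula n
    falseF : ∀ {n} → Formula n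
    _∧F_ _∨F_ _⇒F_ : ∀ {n} → Formula n → Formula n → Formula n
    ∀F ∃F : ∀ {n} → Formula (suc n) → Formula n

  extend : ∀ {n} → B → (Fin n → B) → Fin (suc n) → B
  extend b ρ zero = b
  extend b ρ (suc i) = ρ i

  evalT : ∀ {n} → (Fin n → B) → Term n → B
  evalT ρ (var i) = ρ i
  evalT ρ (par b) = b
  evalT ρ zeroT = 𝟘
  evalT ρ (s ⊕ t) = evalT ρ s + evalT ρ t

  Sat : ∀ {n} → (Fin n → B) → Formula n → Set
  Sat ρ (s ≐ t) = evalT ρ s ≡ evalT ρ t
  Sat ρ falseF = ⊥
  Sat ρ (φ ∧F ψ) = Sat ρ φ × Sat ρ ψ
  Sat ρ (φ ∨F ψ) = Sat ρ φ ⊎ Sat ρ ψ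
  Sat ρ (φ ⇒F ψ) = Sat ρ φ → Sat ρ ψ
  Sat ρ (∀F φ) = ∀ b → Sat (extend b ρ) φ
  Sat ρ (∃F φ) = Σ B λ b → Sat (extend b ρ) φ

  Definable : (B → Set) → Set
  Definable S = Σ (Formula 1) λ φ →
    ∀ b → (S b → Sat (λ _ → b) φ) × (Sat (λ _ → b) φ → S b)

{-# OPTIONS --safe #-}
-- Write u ⋈ v when δ_{u,v} = Id, i.e. u + (v + c) = (u + v) + c for all c.
-- The automorphic inverse property makes ⋈ symmetric, stable under
-- negating both sides, and forces u + v = v + u whenever u ⋈ v.  The Bol
-- identity then shows that u ⋈ y and u ⋈ v imply u ⋈ y + (v + y), so by
-- induction every multiple y · n associates with whatever y and - y
-- associate with; this gives the stability of C_B(x).  Elements of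
-- Z(C_B(x)) associate with every element of C_B(x), which makes the
-- induced operation associative and commutative, and a similar Bol
-- computation shows Z(C_B(x)) is closed under +.  All conditions are
-- first-order in (+, 0) with parameters x and - x.
module Submission where

open import Defs
open import Data.Integer as ℤ using (ℤ; -[1+_])
open import Data.Nat using (zero; suc)
open import Data.Fin using (zero; suc)
open import Data.Product using (_×_; _,_; proj₁; proj₂)
open import Relation.Binary.PropositionalEquality

module KLoopProperties (K : KLoop) where
  open KLoopTheory K
  open ≡-Reasoning

  +-cancelˡ : ∀ a {y y′} → a + y ≡ a + y′ → y ≡ y′
  +-cancelˡ a {y} {y′} eq = trans (unique y refl) (sym (unique y′ (sym eq)))
    where unique = proj₂ (proj₂ (solveʳ a (a + y)))

  -‿inverseʳ : ∀ a → a + - a ≡ 𝟘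
  -‿inverseʳ a = proj₁ (proj₂ (solveʳ a 𝟘))

  -‿cancelˡ : ∀ a c → - a + (a + c) ≡ c
  -‿cancelˡ a c = subst (λ z → z + (a + c) ≡ c) a′≡-a (a′-cancelˡ c)
    where
    a′ = proj₁ (solveˡ a 𝟘)

    a′-cancelˡ : ∀ c → a′ + (a + c) ≡ c
    a′-cancelˡ c = +-cancelˡ a (begin
      a + (a′ + (a + c))  ≡⟨ bol a a′ c ⟩
      (a + (a′ + a)) + c  ≡⟨ cong (λ z → (a + z) + c) (proj₁ (proj₂ (solveˡ a 𝟘))) ⟩
      (a + 𝟘) + c         ≡⟨ cong (_+ c) (identityʳ a) ⟩
      a + c               ∎)

    a′≡-a : a′ ≡ - a
    a′≡-a = begin
      a′             ≡⟨ sym (identityʳ a′) ⟩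
      a′ + 𝟘         ≡⟨ cong (a′ +_) (sym (-‿inverseʳ a)) ⟩
      a′ + (a + - a) ≡⟨ a′-cancelˡ (- a) ⟩
      - a            ∎

  -‿inverseˡ : ∀ a → - a + a ≡ 𝟘
  -‿inverseˡ a = trans (cong (- a +_) (sym (identityʳ a))) (-‿cancelˡ a 𝟘)

  -‿involutive : ∀ a → - (- a) ≡ a
  -‿involutive a = +-cancelˡ (- a) (trans (-‿inverseʳ (- a)) (sym (-‿inverseˡ a)))

  -‿cancelʳ : ∀ a c → a + (- a + c) ≡ c
  -‿cancelʳ a c = subst (λ z → z + (- a + c) ≡ c) (-‿involutive a) (-‿cancelˡ (- a) c)

  -‿injective : ∀ {a b} → - a ≡ - b → a ≡ b
  -‿injective {a} {b} eq = trans (sym (-‿involutive a)) (trans (cong -_ eq) (-‿involutive b))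

  infix 4 _⋈_
  _⋈_ : B → B → Set
  u ⋈ v = ∀ c → u + (v + c) ≡ (u + v) + c

  IsId-δ⇒⋈ : ∀ {u v} → IsId (δ u v) → u ⋈ v
  IsId-δ⇒⋈ {u} {v} δ≡id c = begin
    u + (v + c)            ≡⟨ sym (proj₁ (proj₂ (solveʳ (u + v) (u + (v + c))))) ⟩
    (u + v) + δ u v c      ≡⟨ cong ((u + v) +_) (δ≡id c) ⟩
    (u + v) + c            ∎

  ⋈⇒IsId-δ : ∀ {u v} → u ⋈ v → IsId (δ u v)
  ⋈⇒IsId-δ {u} {v} u⋈v c = sym (proj₂ (proj₂ (solveʳ (u + v) (u + (v + c)))) c (sym (u⋈v c)))

  ⋈-intro : ∀ {u v t} → (∀ c → u + (v + c) ≡ t + c) → u ⋈ v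
  ⋈-intro {u} {v} {t} eq c = trans (eq c) (cong (_+ c) (sym u+v≡t))
    where
    u+v≡t : u + v ≡ t
    u+v≡t = begin
      u + v        ≡⟨ cong (u +_) (sym (identityʳ v)) ⟩
      u + (v + 𝟘)  ≡⟨ eq 𝟘 ⟩
      t + 𝟘        ≡⟨ identityʳ t ⟩
      t            ∎

  ⋈-identityˡ : ∀ {v} → 𝟘 ⋈ v
  ⋈-identityˡ {v} c = trans (identityˡ (v + c)) (cong (_+ c) (sym (identityˡ v)))

  ⋈-identityʳ : ∀ {u} → u ⋈ 𝟘
  ⋈-identityʳ {u} c = trans (cong (u +_) (identityˡ c)) (cong (_+ c) (sym (identityʳ u)))

  ⋈-refl : ∀ {u} → u ⋈ u
  ⋈-refl {u} c = begin
    u + (u + c)        ≡⟨ cong (u +_) (sym (identityˡ (u + c))) ⟩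
    u + (𝟘 + (u + c))  ≡⟨ bol u 𝟘 c ⟩
    (u + (𝟘 + u)) + c  ≡⟨ cong (λ z → (u + z) + c) (identityˡ u) ⟩
    (u + u) + c        ∎

  ⋈-inverse : ∀ {u} → - u ⋈ u
  ⋈-inverse {u} c = begin
    - u + (u + c)  ≡⟨ -‿cancelˡ u c ⟩
    c              ≡⟨ sym (identityˡ c) ⟩
    𝟘 + c          ≡⟨ cong (_+ c) (sym (-‿inverseˡ u)) ⟩
    (- u + u) + c  ∎

  ⋈-neg : ∀ {u v} → u ⋈ v → - u ⋈ - v
  ⋈-neg {u} {v} u⋈v d = begin
    - u + (- v + d)          ≡⟨ cong (λ z → - u + (- v + z)) (sym (-‿involutive d)) ⟩
    - u + (- v + - (- d))    ≡⟨ cong (- u +_) (sym (aip v (- d))) ⟩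
    - u + - (v + - d)        ≡⟨ sym (aip u (v + - d)) ⟩
    - (u + (v + - d))        ≡⟨ cong -_ (u⋈v (- d)) ⟩
    - ((u + v) + - d)        ≡⟨ aip (u + v) (- d) ⟩
    - (u + v) + - (- d)      ≡⟨ cong₂ _+_ (aip u v) (-‿involutive d) ⟩
    (- u + - v) + d          ∎

  ⋈⇒-‿+ : ∀ {u v} → u ⋈ v → ∀ c → - v + (- u + c) ≡ - (u + v) + c
  ⋈⇒-‿+ {u} {v} u⋈v c = +-cancelˡ (u + v) (begin
    (u + v) + (- v + (- u + c))  ≡⟨ sym (u⋈v _) ⟩
    u + (v + (- v + (- u + c)))  ≡⟨ cong (u +_) (-‿cancelʳ v (- u + c)) ⟩
    u + (- u + c)                ≡⟨ -‿cancelʳ u c ⟩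
    c                            ≡⟨ sym (-‿cancelʳ (u + v) c) ⟩
    (u + v) + (- (u + v) + c)    ∎)

  ⋈⇒-‿antihom : ∀ {u v} → u ⋈ v → - v + - u ≡ - (u + v)
  ⋈⇒-‿antihom {u} {v} u⋈v = begin
    - v + - u          ≡⟨ cong (- v +_) (sym (identityʳ (- u))) ⟩
    - v + (- u + 𝟘)    ≡⟨ ⋈⇒-‿+ u⋈v 𝟘 ⟩
    - (u + v) + 𝟘      ≡⟨ identityʳ _ ⟩
    - (u + v)          ∎

  ⋈⇒comm : ∀ {u v} → u ⋈ v → u + v ≡ v + u
  ⋈⇒comm {u} {v} u⋈v = -‿injective (trans (sym (⋈⇒-‿antihom u⋈v)) (sym (aip v u)))

  ⋈-reverse : ∀ {u v} → u ⋈ v → - v ⋈ - u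
  ⋈-reverse u⋈v c = trans (⋈⇒-‿+ u⋈v c) (cong (_+ c) (sym (⋈⇒-‿antihom u⋈v)))

  ⋈-sym : ∀ {u v} → u ⋈ v → v ⋈ u
  ⋈-sym {u} {v} u⋈v = subst₂ _⋈_ (-‿involutive v) (-‿involutive u) (⋈-reverse (⋈-neg u⋈v))

  ⋈-neg-moveʳ : ∀ {u v} → - u ⋈ v → u ⋈ - v
  ⋈-neg-moveʳ {u} {v} -u⋈v = subst (_⋈ - v) (-‿involutive u) (⋈-neg -u⋈v)

  ⋈-neg-moveˡ : ∀ {u v} → u ⋈ - v → - u ⋈ v
  ⋈-neg-moveˡ {u} {v} u⋈-v = subst (- u ⋈_) (-‿involutive v) (⋈-neg u⋈-v)

  ⋈-bol : ∀ {u y v} → u ⋈ y → u ⋈ v → u ⋈ y + (v + y)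
  ⋈-bol {u} {y} {v} u⋈y u⋈v = ⋈-intro λ c → begin
    u + ((y + (v + y)) + c)   ≡⟨ cong (u +_) (sym (bol y v c)) ⟩
    u + (y + (v + (y + c)))   ≡⟨ u⋈y _ ⟩
    (u + y) + (v + (y + c))   ≡⟨ cong (_+ (v + (y + c))) (⋈⇒comm u⋈y) ⟩
    (y + u) + (v + (y + c))   ≡⟨ sym (⋈-sym u⋈y _) ⟩
    y + (u + (v + (y + c)))   ≡⟨ cong (y +_) (u⋈v _) ⟩
    y + ((u + v) + (y + c))   ≡⟨ bol y (u + v) c ⟩
    (y + ((u + v) + y)) + c   ∎

  ⋈-·ℕ : ∀ {u y} → u ⋈ y → ∀ k → u ⋈ y ·ℕ k
  ⋈-·ℕ u⋈y zero = ⋈-identityʳ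
  ⋈-·ℕ {u} {y} u⋈y (suc zero) = subst (u ⋈_) (sym (identityʳ y)) u⋈y
  ⋈-·ℕ {u} {y} u⋈y (suc (suc k)) =
    subst (u ⋈_) (cong (y +_) (sym (⋈⇒comm (⋈-·ℕ ⋈-refl k))))
      (⋈-bol u⋈y (⋈-·ℕ u⋈y k))

  ⋈-· : ∀ {u y} → u ⋈ y → u ⋈ - y → ∀ n → u ⋈ y · n
  ⋈-· u⋈y u⋈-y (ℤ.+ k) = ⋈-·ℕ u⋈y k
  ⋈-· u⋈y u⋈-y -[1+ k ] = ⋈-neg-moveʳ (⋈-·ℕ (⋈-neg-moveˡ u⋈-y) (suc k))

  Centraliser : B → B → Set
  Centraliser x b = x ⋈ b × - x ⋈ b

  Centre : B → B → Set
  Centre x b = Centraliser x b × (∀ b′ → Centraliser x b′ → b ⋈ b′)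

  C⇒Centraliser : ∀ {x b} → C x b → Centraliser x b
  C⇒Centraliser (p , q) = IsId-δ⇒⋈ p , IsId-δ⇒⋈ q

  Centraliser⇒C : ∀ {x b} → Centraliser x b → C x b
  Centraliser⇒C (p , q) = ⋈⇒IsId-δ p , ⋈⇒IsId-δ q

  ZC⇒Centre : ∀ {x b} → ZC x b → Centre x b
  ZC⇒Centre (cb , central) = C⇒Centraliser cb , λ b′ cb′ → IsId-δ⇒⋈ (central b′ (Centraliser⇒C cb′))

  Centre⇒ZC : ∀ {x b} → Centre x b → ZC x b
  Centre⇒ZC (cb , central) = Centraliser⇒C cb , λ b′ cb′ → ⋈⇒IsId-δ (central b′ (C⇒Centraliser cb′))

  ⋈⇒⋈-+ : ∀ {u v} → u ⋈ v → u ⋈ u + v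
  ⋈⇒⋈-+ {u} {v} u⋈v c = begin
    u + ((u + v) + c)  ≡⟨ cong (λ z → u + (z + c)) (⋈⇒comm u⋈v) ⟩
    u + ((v + u) + c)  ≡⟨ cong (u +_) (sym (⋈-sym u⋈v c)) ⟩
    u + (v + (u + c))  ≡⟨ bol u v c ⟩
    (u + (v + u)) + c  ≡⟨ cong (λ z → (u + z) + c) (sym (⋈⇒comm u⋈v)) ⟩
    (u + (u + v)) + c  ∎

  ⋈⇒-⋈-+ : ∀ {u v} → u ⋈ v → - u ⋈ u + v
  ⋈⇒-⋈-+ {u} {v} u⋈v c = begin
    - u + ((u + v) + c)  ≡⟨ cong (- u +_) (sym (u⋈v c)) ⟩
    - u + (u + (v + c))  ≡⟨ -‿cancelˡ u (v + c) ⟩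
    v + c                ≡⟨ cong (_+ c) (sym (-‿cancelˡ u v)) ⟩
    (- u + (u + v)) + c  ∎

  ⋈-+ : ∀ {u b b′} → u ⋈ b → b ⋈ b′ → u ⋈ b′ → b ⋈ u + b′ → u ⋈ b + b′
  ⋈-+ {u} {b} {b′} u⋈b b⋈b′ u⋈b′ b⋈u+b′ = ⋈-intro λ c → begin
    u + ((b + b′) + c)   ≡⟨ cong (u +_) (sym (b⋈b′ c)) ⟩
    u + (b + (b′ + c))   ≡⟨ u⋈b _ ⟩
    (u + b) + (b′ + c)   ≡⟨ cong (_+ (b′ + c)) (⋈⇒comm u⋈b) ⟩
    (b + u) + (b′ + c)   ≡⟨ sym (⋈-sym u⋈b _) ⟩
    b + (u + (b′ + c))   ≡⟨ cong (b +_) (u⋈b′ c) ⟩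
    b + ((u + b′) + c)   ≡⟨ b⋈u+b′ c ⟩
    (b + (u + b′)) + c   ∎

  Centraliser-· : ∀ {x y} → Centraliser x y → ∀ n → Centraliser x (y · n)
  Centraliser-· (x⋈y , -x⋈y) n = ⋈-· x⋈y (⋈-neg-moveʳ -x⋈y) n , ⋈-· -x⋈y (⋈-neg x⋈y) n

  Centraliser-neg : ∀ {x b} → Centraliser x b → Centraliser x (- b)
  Centraliser-neg (x⋈b , -x⋈b) = ⋈-neg-moveʳ -x⋈b , ⋈-neg x⋈b

  Centraliser-+ : ∀ {x b b′} → Centre x b → Centraliser x b′ → Centraliser x (b + b′)
  Centraliser-+ {x} {b} {b′} ((x⋈b , -x⋈b) , central) cb′@(x⋈b′ , -x⋈b′) =
      ⋈-+ x⋈b b⋈b′ x⋈b′ (central (x + b′) (⋈⇒⋈-+ x⋈b′ , ⋈⇒-⋈-+ x⋈b′))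
    , ⋈-+ -x⋈b b⋈b′ -x⋈b′ (central (- x + b′) (x⋈-x+b′ , ⋈⇒⋈-+ -x⋈b′))
    where
    b⋈b′ = central b′ cb′
    x⋈-x+b′ = subst (_⋈ - x + b′) (-‿involutive x) (⋈⇒-⋈-+ -x⋈b′)

  Centre-𝟘 : ∀ {x} → Centre x 𝟘
  Centre-𝟘 = (⋈-identityʳ , ⋈-identityʳ) , λ _ _ → ⋈-identityˡ

  Centre-neg : ∀ {x b} → Centre x b → Centre x (- b)
  Centre-neg (cb , central) =
    Centraliser-neg cb , λ b′ cb′ → ⋈-neg-moveˡ (central (- b′) (Centraliser-neg cb′))

  Centre-+ : ∀ {x a b} → Centre x a → Centre x b → Centre x (a + b)
  Centre-+ {x} {a} {b} za@(_ , central-a) zb@(cb , central-b) =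
    Centraliser-+ za cb , λ b′ cb′ c → begin
      (a + b) + (b′ + c)   ≡⟨ sym (a⋈b _) ⟩
      a + (b + (b′ + c))   ≡⟨ cong (a +_) (central-b b′ cb′ c) ⟩
      a + ((b + b′) + c)   ≡⟨ central-a (b + b′) (Centraliser-+ zb cb′) c ⟩
      (a + (b + b′)) + c   ≡⟨ cong (_+ c) (a⋈b b′) ⟩
      ((a + b) + b′) + c   ∎
    where a⋈b = central-a b cb

  Centre-solveˡ : ∀ {x a b} → Centre x a → Centre x b → Centre x (proj₁ (solveˡ a b))
  Centre-solveˡ {x} {a} {b} za zb@(_ , central-b) =
    subst (Centre x) (proj₂ (proj₂ (solveˡ a b)) (b + - a) b-a+a≡b) (Centre-+ zb (Centre-neg za))
    where
    b-a+a≡b : (b + - a) + a ≡ b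
    b-a+a≡b = begin
      (b + - a) + a  ≡⟨ sym (central-b (- a) (proj₁ (Centre-neg za)) a) ⟩
      b + (- a + a)  ≡⟨ cong (b +_) (-‿inverseˡ a) ⟩
      b + 𝟘          ≡⟨ identityʳ b ⟩
      b              ∎

  Centre-solveʳ : ∀ {x a b} → Centre x a → Centre x b → Centre x (proj₁ (solveʳ a b))
  Centre-solveʳ {x} {a} {b} za zb =
    subst (Centre x) (proj₂ (proj₂ (solveʳ a b)) (- a + b) (-‿cancelʳ a b)) (Centre-+ (Centre-neg za) zb)

  Centre-· : ∀ x n → Centre x (x · n)
  Centre-· x n = Centraliser-· (⋈-refl , ⋈-inverse) n
    , λ b′ (x⋈b′ , -x⋈b′) → ⋈-sym (⋈-· (⋈-sym x⋈b′) (⋈-sym -x⋈b′) n)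

  -- Both terms live in the context extended by the bound variable c = var zero.
  associatesF : ∀ {n} → Term (suc n) → Term (suc n) → Formula n
  associatesF s t = ∀F ((s ⊕ (t ⊕ var zero)) ≐ ((s ⊕ t) ⊕ var zero))

  centraliserF : ∀ {n} → B → Term (suc n) → Formula n
  centraliserF x t = associatesF (par x) t ∧F associatesF (par (- x)) t

  centreF : B → Formula 1
  centreF x = centraliserF x (var (suc zero))
    ∧F ∀F (centraliserF x (var (suc zero)) ⇒F associatesF (var (suc (suc zero))) (var (suc zero)))

  -- Sat (λ _ → b) (centreF x) unfolds definitionally to Centre x b.
  ZC-definable : ∀ x → Definable (ZC x)
  ZC-definable x = centreF x , λ b → ZC⇒Centre , Centre⇒ZC

  ZC-isSubloop : ∀ x → IsSubloop (ZC x)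
  ZC-isSubloop x = Centre⇒ZC Centre-𝟘
    , (λ a b za zb → Centre⇒ZC (Centre-+ (ZC⇒Centre za) (ZC⇒Centre zb)))
    , (λ a b za zb → Centre⇒ZC (Centre-solveˡ (ZC⇒Centre za) (ZC⇒Centre zb)))
    , (λ a b za zb → Centre⇒ZC (Centre-solveʳ (ZC⇒Centre za) (ZC⇒Centre zb)))

  ZC-isAbelianGroup : ∀ x → IsAbelianGroupOn (ZC x)
  ZC-isAbelianGroup x =
      (λ a b c za zb _ → sym (a⋈b za zb c))
    , (λ a b za zb → ⋈⇒comm (a⋈b za zb))
    where
    a⋈b : ∀ {a b} → ZC x a → ZC x b → a ⋈ b
    a⋈b za zb = proj₂ (ZC⇒Centre za) _ (proj₁ (ZC⇒Centre zb))

mainTheorem3 : (K : KLoop) → let open KLoopTheory K in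
    FixedPointFree → (x : B) →
    ((y : B) → C x y → (n : ℤ) → C x (y · n))
    × Definable (ZC x)
    × IsSubloop (ZC x)
    × IsAbelianGroupOn (ZC x)
    × ((n : ℤ) → ZC x (x · n))
mainTheorem3 K _ x =
    (λ y cy n → Centraliser⇒C (Centraliser-· (C⇒Centraliser cy) n))
  , ZC-definable x
  , ZC-isSubloop x
  , ZC-isAbelianGroup x
  , (λ n → Centre⇒ZC (Centre-· x n))
  where open KLoopProperties K
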